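{- For every $D\ge3$ there is no graph of degree $7$, diameter $D$ and cyclic defect. Furthermore, for every odd $g\ge7$ there is no graph of degree $7$, girth $g$ and cyclic excess.
   Context: For an integer $d\ge 1$ define polynomials $G_{d,m}(x)$ by $G_{d,0}(x)=1$, $G_{d,1}(x)=x+1$, and $G_{d,m+1}(x)=xG_{d,m}(x)-(d-1)G_{d,m-1}(x)$ for $m\ge1$. Let $J_n$ be the $n\times n$ all-ones matrix. For a graph on $n\ge3$ vertices, a cycle matrix is the adjacency matrix $B$ of an $n$-cycle on the same vertex set (i.e., for some ordering $v_1,\dots,v_n$ of the vertices, $B_{ij}=1$ iff $v_i,v_j$ are cyclically consecutive, and $0$ otherwise); this cycle need not consist of edges of the graph. A graph $\Gamma$ of order $n$ with adjacency matrix $A$ is a graph of degree $d$, diameter $D$ and cyclic defect if $\Gamma$ is $d$-regular with $d\ge3$, has diameter $D\ge2$, and $G_{d,D}(A)=J_n+B$ for some cycle matrix $B$. It is a graph of degree $d$, girth $g$ and cyclic excess if $\Gamma$ is $d$-regular with $d\ge3$, has odd girth $g\ge5$, and $G_{d,\lfloor g/2\rfloor}(A)=J_n-B$ for some cycle matrix $B$. -}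

module Defs where

open import Data.Nat as ℕ using (ℕ; zero; suc; _≤_; _<_; _∸_; _≡ᵇ_)
open import Data.Integer as ℤ using (ℤ; +_; _-_)
open import Data.Bool using (Bool; true; false; if_then_else_; _∨_; _∧_)
open import Data.Fin using (Fin; toℕ)
open import Data.Fin.Permutation using (Permutation′; _⟨$⟩ʳ_)
open import Data.Product using (Σ; ∃; _×_; _,_)
open import Relation.Binary.PropositionalEquality using (_≡_; _≢_)
open import Relation.Nullary using (¬_)

record Graph (n : ℕ) : Set where
  field
    adj     : Fin n → Fin n → Bool
    symm    : ∀ i j → adj i j ≡ adj j i
    irrefl  : ∀ i → adj i i ≡ false
open Graph public

Mat : ℕ → Set
Mat n = Fin n → Fin n → ℤ

sumFin : ∀ {n} → (Fin n → ℤ) → ℤ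
sumFin {zero}  f = + 0
sumFin {suc n} f = f Fin.zero ℤ.+ sumFin (λ i → f (Fin.suc i))

b2z : Bool → ℤ
b2z true  = + 1
b2z false = + 0

_⊕_ : ∀ {n} → Mat n → Mat n → Mat n
(M ⊕ N) i j = M i j ℤ.+ N i j

_⊖_ : ∀ {n} → Mat n → Mat n → Mat n
(M ⊖ N) i j = M i j - N i j

_⊛_ : ∀ {n} → Mat n → Mat n → Mat n
(M ⊛ N) i j = sumFin (λ k → M i k ℤ.* N k j)

_·_ : ∀ {n} → ℤ → Mat n → Mat n
(c · M) i j = c ℤ.* M i j

Id : ∀ {n} → Mat n
Id i j = b2z (toℕ i ≡ᵇ toℕ j)

Jm : ∀ {n} → Mat n
Jm i j = + 1

_≋_ : ∀ {n} → Mat n → Mat n → Set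
M ≋ N = ∀ i j → M i j ≡ N i j

adjMat : ∀ {n} → Graph n → Mat n
adjMat Γ i j = b2z (adj Γ i j)

Gpoly : ∀ {n} → ℕ → ℕ → Mat n → Mat n
Gpoly d zero          X = Id
Gpoly d (suc zero)    X = X ⊕ Id
Gpoly d (suc (suc m)) X = (X ⊛ Gpoly d (suc m) X) ⊖ ((+ (d ∸ 1)) · Gpoly d m X)

-- Cycle matrices: adjacency matrix of an n-cycle on Fin n.
-- A permutation π assigns to each vertex its position in the cyclic
-- ordering v_1,...,v_n; positions a, b are cyclically consecutive.

cyclicConsec : ℕ → ℕ → ℕ → Bool
cyclicConsec n a b =
  (suc a ≡ᵇ b) ∨ (suc b ≡ᵇ a) ∨ ((a ≡ᵇ 0) ∧ (b ≡ᵇ (n ∸ 1))) ∨ ((b ≡ᵇ 0) ∧ (a ≡ᵇ (n ∸ 1)))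

cycleMat : ∀ {n} → Permutation′ n → Mat n
cycleMat {n} π i j = b2z (cyclicConsec n (toℕ (π ⟨$⟩ʳ i)) (toℕ (π ⟨$⟩ʳ j)))

IsCycleMatrix : ∀ {n} → Mat n → Set
IsCycleMatrix {n} B = 3 ≤ n × Σ (Permutation′ n) (λ π → B ≋ cycleMat π)

degree : ∀ {n} → Graph n → Fin n → ℤ
degree Γ i = sumFin (λ j → adjMat Γ i j)

Regular : ∀ {n} → ℕ → Graph n → Set
Regular d Γ = ∀ i → degree Γ i ≡ + d

data Walk {n} (Γ : Graph n) : ℕ → Fin n → Fin n → Set where
  here : ∀ {i} → Walk Γ zero i i
  step : ∀ {k i j l} → adj Γ i j ≡ true → Walk Γ k j l → Walk Γ (suc k) i l

DistLE : ∀ {n} → Graph n → ℕ → Fin n → Fin n → Set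
DistLE Γ k i j = ∃ λ m → m ≤ k × Walk Γ m i j

HasDiameter : ∀ {n} → Graph n → ℕ → Set
HasDiameter Γ D =
  (∀ i j → DistLE Γ D i j) × ∃ λ i → ∃ λ j → ¬ DistLE Γ (D ∸ 1) i j

record Cycle {n} (Γ : Graph n) (k : ℕ) : Set where
  field
    len≥3  : 3 ≤ k
    vtx    : ℕ → Fin n
    inj    : ∀ a b → a < k → b < k → vtx a ≡ vtx b → a ≡ b
    edges  : ∀ a → suc a < k → adj Γ (vtx a) (vtx (suc a)) ≡ true
    closes : adj Γ (vtx (k ∸ 1)) (vtx 0) ≡ true

HasGirth : ∀ {n} → Graph n → ℕ → Set
HasGirth Γ g = Cycle Γ g × (∀ k → k < g → ¬ Cycle Γ k)

CyclicDefect : ∀ {n} → Graph n → ℕ → ℕ → Set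
CyclicDefect {n} Γ d D =
  3 ≤ d × Regular d Γ × 2 ≤ D × HasDiameter Γ D ×
  Σ (Mat n) (λ B → IsCycleMatrix B × (Gpoly d D (adjMat Γ) ≋ (Jm ⊕ B)))

CyclicExcess : ∀ {n} → Graph n → ℕ → ℕ → Set
CyclicExcess {n} Γ d g =
  3 ≤ d × Regular d Γ × HasGirth Γ g × g ℕ.% 2 ≡ 1 × 5 ≤ g ×
  Σ (Mat n) (λ B → IsCycleMatrix B × (Gpoly d (g ℕ./ 2) (adjMat Γ) ≋ (Jm ⊖ B)))

-- Write the identity as G(A) = J + εB with ε = ±1 (ε = 1 and m = D for a cyclic defect, ε = −1 and
-- m = ⌊g/2⌋ for a cyclic excess). On the all-ones vector it reads G_{7,m}(7) = n + 2ε, and G_{7,m}(7)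
-- is even, so the cycle has even length. Its alternating vector z is then a (−2)-eigenvector of B
-- summing to 0, whence G(A)z = −2εz. Since A commutes with G(A) and, being regular, preserves zero
-- sums, Az is again in the (−2)-eigenspace of B, which for an even cycle is spanned by z. So Az = θz
-- with θ = 7 − 2t for some t ≤ 7, and G_{7,m}(θ) = −2ε. For each of the eight values of θ, the residues
-- of G_{7,m}(θ) modulo a small integer are eventually periodic and never equal −2ε for m ≥ 3.

module Submission where

open import Defs
open import Data.Nat as ℕ using (ℕ; zero; suc; _≤_; _<_; _%_; _≡ᵇ_; s≤s; z≤n; NonZero)
import Data.Nat.Properties as ℕP
open import Data.Nat.Divisibility using (_∣_)
open import Data.Nat.DivMod using (m<n⇒m%n≡m; n%n≡0; m%n<n; m≡m%n+[m/n]*n; _mod_; /-monoˡ-≤)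
open import Data.Nat.GeneralisedArithmetic using (fold; fold-+)
open import Data.Integer as ℤ using (ℤ; +_; _+_; _*_; -_; _-_; _%ℕ_; _/ℕ_)
import Data.Integer.Properties as ℤP
open import Data.Integer.DivMod using (a≡a%ℕn+[a/ℕn]*n)
import Data.Integer.Divisibility.Signed as ℤ∣
open ℤ∣ using (divides; _∣?_)
open import Data.Integer.Tactic.RingSolver using (solve-∀)
open import Data.Fin using (Fin; toℕ; zero; suc)
open import Data.Fin.Properties using (toℕ<n; toℕ-fromℕ<; toℕ-injective; all?)
open import Data.Fin.Permutation using (Permutation′; _⟨$⟩ʳ_; _⟨$⟩ˡ_; inverseˡ; inverseʳ)
open import Data.Vec.Functional using (Vector)
open import Data.Bool using (Bool; true; false; T)
open import Data.Bool.Properties using (T-∨; T-∧)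
open import Data.Empty using (⊥; ⊥-elim)
open import Data.Sum using (_⊎_; inj₁; inj₂)
import Data.Sum as Sum
open import Data.Sum.Function.Propositional using (_⊎-⇔_)
open import Data.Product using (∃; ∃₂; _×_; _,_; proj₁)
open import Data.Product.Function.NonDependent.Propositional using (_×-⇔_)
open import Function using (_⇔_; mk⇔; Equivalence)
open import Function.Properties.Equivalence using () renaming (trans to ⇔-trans; sym to ⇔-sym)
open import Relation.Binary.PropositionalEquality
open import Relation.Nullary using (¬_; ¬?; Dec)
open import Relation.Nullary.Decidable using (True; toWitness)
open import Algebra.Properties.Semiring.Sum ℤP.+-*-semiring
  using (sum; sum-cong-≗; ∑-distrib-+; ∑-comm; *-distribˡ-sum; *-distribʳ-sum; sum-replicate-zero; sum-permute)

sumFin≡sum : ∀ {n} (f : Vector ℤ n) → sumFin f ≡ sum f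
sumFin≡sum {zero}  f = refl
sumFin≡sum {suc n} f = cong (_+_ (f zero)) (sumFin≡sum (λ i → f (suc i)))

∑-distrib-- : ∀ {n} (f g : Vector ℤ n) → sum (λ j → f j - g j) ≡ sum f - sum g
∑-distrib-- f g = begin
  sum (λ j → f j - g j)            ≡⟨ ∑-distrib-+ f (λ j → - g j) ⟩
  sum f + sum (λ j → - g j)        ≡⟨ cong (_+_ (sum f)) (sum-cong-≗ (λ j → ℤP.-1*i≡-i (g j))) ⟨
  sum f + sum (λ j → - + 1 * g j)  ≡⟨ cong (_+_ (sum f)) (*-distribˡ-sum (- + 1) g) ⟨
  sum f + - + 1 * sum g            ≡⟨ cong (_+_ (sum f)) (ℤP.-1*i≡-i (sum g)) ⟩
  sum f - sum g                    ∎
  where open ≡-Reasoning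

sum-ones : ∀ n → sum (λ (_ : Fin n) → + 1) ≡ + n
sum-ones zero    = refl
sum-ones (suc n) = cong (_+_ (+ 1)) (sum-ones n)

sum-δ : ∀ {n} c → c < n → (f : ℕ → ℤ) → sum (λ (p : Fin n) → b2z (toℕ p ≡ᵇ c) * f (toℕ p)) ≡ f c
sum-δ {suc n} zero    _         f =
  trans (cong₂ _+_ (ℤP.*-identityˡ (f 0)) (sum-replicate-zero n)) (ℤP.+-identityʳ (f 0))
sum-δ {suc n} (suc c) (s≤s c<n) f = trans (ℤP.+-identityˡ _) (sum-δ c c<n (λ b → f (suc b)))

signed-count : ∀ {n} (a : Fin n → Bool) (s : Vector ℤ n) → (∀ j → s j ≡ + 1 ⊎ s j ≡ - + 1) →
               ∃₂ λ c t → sum (λ j → b2z (a j)) ≡ + c × t ≤ c ×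
                          sum (λ j → b2z (a j) * s j) ≡ + c - + 2 * + t
signed-count {zero}  a s ±1 = 0 , 0 , refl , z≤n , refl
signed-count {suc n} a s ±1
  with signed-count (λ j → a (suc j)) (λ j → s (suc j)) (λ j → ±1 (suc j)) | a zero | ±1 zero
... | c , t , count , t≤c , total | true  | inj₁ s₀≡1 =
  suc c , t , cong (_+_ (+ 1)) count , ℕP.m≤n⇒m≤1+n t≤c ,
  trans (cong₂ (λ x y → + 1 * x + y) s₀≡1 total) (plus (+ c) (+ t))
  where
  plus : ∀ c t → + 1 * + 1 + (c - + 2 * t) ≡ (+ 1 + c) - + 2 * t
  plus = solve-∀
... | c , t , count , t≤c , total | true  | inj₂ s₀≡-1 =
  suc c , suc t , cong (_+_ (+ 1)) count , s≤s t≤c ,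
  trans (cong₂ (λ x y → + 1 * x + y) s₀≡-1 total) (minus (+ c) (+ t))
  where
  minus : ∀ c t → + 1 * - + 1 + (c - + 2 * t) ≡ (+ 1 + c) - + 2 * (+ 1 + t)
  minus = solve-∀
... | c , t , count , t≤c , total | false | _ =
  c , t , trans (ℤP.+-identityˡ _) count , t≤c , trans (ℤP.+-identityˡ _) total

infixr 7 _*ᵥ_

_*ᵥ_ : ∀ {n} → Mat n → Vector ℤ n → Vector ℤ n
(M *ᵥ v) i = sum (λ j → M i j * v j)

module _ {n : ℕ} where

  *ᵥ-congˡ : ∀ {M N : Mat n} → M ≋ N → ∀ v → M *ᵥ v ≗ N *ᵥ v
  *ᵥ-congˡ M≋N v i = sum-cong-≗ (λ j → cong (_* v j) (M≋N i j))

  *ᵥ-congʳ : ∀ (M : Mat n) {u v : Vector ℤ n} → u ≗ v → M *ᵥ u ≗ M *ᵥ v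
  *ᵥ-congʳ M u≗v i = sum-cong-≗ (λ j → cong (M i j *_) (u≗v j))

  *ᵥ-scale : ∀ (M : Mat n) c (v : Vector ℤ n) → M *ᵥ (λ j → c * v j) ≗ λ i → c * (M *ᵥ v) i
  *ᵥ-scale M c v i =
    trans (sum-cong-≗ (λ j → swap (M i j) c (v j))) (sym (*-distribˡ-sum c (λ j → M i j * v j)))
    where
    swap : ∀ a b x → a * (b * x) ≡ b * (a * x)
    swap = solve-∀

  *ᵥ-plus : ∀ (M : Mat n) (u v : Vector ℤ n) → M *ᵥ (λ j → u j + v j) ≗ λ i → (M *ᵥ u) i + (M *ᵥ v) i
  *ᵥ-plus M u v i = trans (sum-cong-≗ (λ j → ℤP.*-distribˡ-+ (M i j) (u j) (v j)))
    (∑-distrib-+ (λ j → M i j * u j) (λ j → M i j * v j))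

  *ᵥ-minus : ∀ (M : Mat n) (u v : Vector ℤ n) → M *ᵥ (λ j → u j - v j) ≗ λ i → (M *ᵥ u) i - (M *ᵥ v) i
  *ᵥ-minus M u v i = trans (sum-cong-≗ (λ j → expand (M i j) (u j) (v j)))
    (∑-distrib-- (λ j → M i j * u j) (λ j → M i j * v j))
    where
    expand : ∀ a x y → a * (x - y) ≡ a * x - a * y
    expand = solve-∀

  ⊛-*ᵥ : ∀ (X Y : Mat n) v → (X ⊛ Y) *ᵥ v ≗ X *ᵥ (Y *ᵥ v)
  ⊛-*ᵥ X Y v i = begin
    sum (λ j → sumFin (λ k → X i k * Y k j) * v j)
      ≡⟨ sum-cong-≗ (λ j → cong (_* v j) (sumFin≡sum (λ k → X i k * Y k j))) ⟩
    sum (λ j → sum (λ k → X i k * Y k j) * v j)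
      ≡⟨ sum-cong-≗ (λ j → *-distribʳ-sum (v j) (λ k → X i k * Y k j)) ⟩
    sum (λ j → sum (λ k → X i k * Y k j * v j))
      ≡⟨ ∑-comm (λ j k → X i k * Y k j * v j) ⟩
    sum (λ k → sum (λ j → X i k * Y k j * v j))
      ≡⟨ sum-cong-≗ (λ k → sum-cong-≗ (λ j → ℤP.*-assoc (X i k) (Y k j) (v j))) ⟩
    sum (λ k → sum (λ j → X i k * (Y k j * v j)))
      ≡⟨ sum-cong-≗ (λ k → *-distribˡ-sum (X i k) (λ j → Y k j * v j)) ⟨
    sum (λ k → X i k * (Y *ᵥ v) k) ∎
    where open ≡-Reasoning

  ⊕-*ᵥ : ∀ (X Y : Mat n) v → (X ⊕ Y) *ᵥ v ≗ λ i → (X *ᵥ v) i + (Y *ᵥ v) i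
  ⊕-*ᵥ X Y v i = trans (sum-cong-≗ (λ j → ℤP.*-distribʳ-+ (v j) (X i j) (Y i j)))
    (∑-distrib-+ (λ j → X i j * v j) (λ j → Y i j * v j))

  ⊖-*ᵥ : ∀ (X Y : Mat n) v → (X ⊖ Y) *ᵥ v ≗ λ i → (X *ᵥ v) i - (Y *ᵥ v) i
  ⊖-*ᵥ X Y v i = trans (sum-cong-≗ (λ j → expand (X i j) (Y i j) (v j)))
    (∑-distrib-- (λ j → X i j * v j) (λ j → Y i j * v j))
    where
    expand : ∀ a b x → (a - b) * x ≡ a * x - b * x
    expand = solve-∀

  ·-*ᵥ : ∀ c (X : Mat n) v → (c · X) *ᵥ v ≗ λ i → c * (X *ᵥ v) i
  ·-*ᵥ c X v i =
    trans (sum-cong-≗ (λ j → ℤP.*-assoc c (X i j) (v j))) (sym (*-distribˡ-sum c (λ j → X i j * v j)))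

  Jm-*ᵥ : ∀ (v : Vector ℤ n) → Jm *ᵥ v ≗ λ _ → sum v
  Jm-*ᵥ v i = sum-cong-≗ (λ j → ℤP.*-identityˡ (v j))

Id-*ᵥ : ∀ {n} (v : Vector ℤ n) → Id *ᵥ v ≗ v
Id-*ᵥ {suc n} v zero    =
  trans (cong₂ _+_ (ℤP.*-identityˡ (v zero)) (sum-replicate-zero n)) (ℤP.+-identityʳ (v zero))
Id-*ᵥ {suc n} v (suc i) = trans (ℤP.+-identityˡ _) (Id-*ᵥ (λ j → v (suc j)) i)

Gscalar : ℕ → ℕ → ℤ → ℤ
Gscalar d zero          θ = + 1
Gscalar d (suc zero)    θ = θ + + 1
Gscalar d (suc (suc m)) θ = θ * Gscalar d (suc m) θ - + (d ℕ.∸ 1) * Gscalar d m θ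

Gscalar-even : ∀ d θ → + 2 ℤ∣.∣ θ + + 1 → + 2 ℤ∣.∣ + (d ℕ.∸ 1) →
               ∀ {m} → 1 ≤ m → + 2 ℤ∣.∣ Gscalar d m θ
Gscalar-even d θ 2∣θ+1 2∣d-1 {suc zero}    _ = 2∣θ+1
Gscalar-even d θ 2∣θ+1 2∣d-1 {suc (suc m)} _ = ℤ∣.∣m∣n⇒∣m-n
  (ℤ∣.∣n⇒∣m*n θ (Gscalar-even d θ 2∣θ+1 2∣d-1 {suc m} (s≤s z≤n)))
  (ℤ∣.∣m⇒∣m*n (Gscalar d m θ) 2∣d-1)

module _ {n : ℕ} (d : ℕ) (A : Mat n) where

  private
    c : ℤ
    c = + (d ℕ.∸ 1)

  Gpoly-*ᵥ-one : ∀ v → Gpoly d 1 A *ᵥ v ≗ λ i → (A *ᵥ v) i + v i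
  Gpoly-*ᵥ-one v i = trans (⊕-*ᵥ A Id v i) (cong (_+_ ((A *ᵥ v) i)) (Id-*ᵥ v i))

  Gpoly-*ᵥ-step : ∀ m v → Gpoly d (2 ℕ.+ m) A *ᵥ v ≗
                  λ i → (A *ᵥ (Gpoly d (1 ℕ.+ m) A *ᵥ v)) i - c * (Gpoly d m A *ᵥ v) i
  Gpoly-*ᵥ-step m v i = trans (⊖-*ᵥ (A ⊛ Gpoly d (1 ℕ.+ m) A) (c · Gpoly d m A) v i)
    (cong₂ _-_ (⊛-*ᵥ A (Gpoly d (1 ℕ.+ m) A) v i) (·-*ᵥ c (Gpoly d m A) v i))

  Gpoly-eigen : ∀ θ v → A *ᵥ v ≗ (λ i → θ * v i) → ∀ m → Gpoly d m A *ᵥ v ≗ λ i → Gscalar d m θ * v i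
  Gpoly-eigen θ v Av zero i = trans (Id-*ᵥ v i) (sym (ℤP.*-identityˡ (v i)))
  Gpoly-eigen θ v Av (suc zero) i = begin
    (Gpoly d 1 A *ᵥ v) i  ≡⟨ Gpoly-*ᵥ-one v i ⟩
    (A *ᵥ v) i + v i      ≡⟨ cong (_+ v i) (Av i) ⟩
    θ * v i + v i         ≡⟨ collect θ (v i) ⟩
    (θ + + 1) * v i       ∎
    where
    open ≡-Reasoning
    collect : ∀ t x → t * x + x ≡ (t + + 1) * x
    collect = solve-∀
  Gpoly-eigen θ v Av (suc (suc m)) i = begin
    (Gpoly d (2 ℕ.+ m) A *ᵥ v) i
      ≡⟨ Gpoly-*ᵥ-step m v i ⟩
    (A *ᵥ (Gpoly d (1 ℕ.+ m) A *ᵥ v)) i - c * (Gpoly d m A *ᵥ v) i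
      ≡⟨ cong₂ (λ x y → x - c * y)
           (trans (*ᵥ-congʳ A (Gpoly-eigen θ v Av (suc m)) i) (*ᵥ-scale A g₁ v i))
           (Gpoly-eigen θ v Av m i) ⟩
    g₁ * (A *ᵥ v) i - c * (g₀ * v i)
      ≡⟨ cong (λ x → g₁ * x - c * (g₀ * v i)) (Av i) ⟩
    g₁ * (θ * v i) - c * (g₀ * v i)
      ≡⟨ collect g₁ θ c g₀ (v i) ⟩
    Gscalar d (2 ℕ.+ m) θ * v i ∎
    where
    open ≡-Reasoning
    g₁ = Gscalar d (1 ℕ.+ m) θ
    g₀ = Gscalar d m θ
    collect : ∀ g₁ t c g₀ x → g₁ * (t * x) - c * (g₀ * x) ≡ (t * g₁ - c * g₀) * x
    collect = solve-∀

  Gpoly-comm : ∀ v m → Gpoly d m A *ᵥ (A *ᵥ v) ≗ A *ᵥ (Gpoly d m A *ᵥ v)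
  Gpoly-comm v zero i = trans (Id-*ᵥ (A *ᵥ v) i) (*ᵥ-congʳ A (λ j → sym (Id-*ᵥ v j)) i)
  Gpoly-comm v (suc zero) i = begin
    (Gpoly d 1 A *ᵥ (A *ᵥ v)) i        ≡⟨ Gpoly-*ᵥ-one (A *ᵥ v) i ⟩
    (A *ᵥ (A *ᵥ v)) i + (A *ᵥ v) i     ≡⟨ *ᵥ-plus A (A *ᵥ v) v i ⟨
    (A *ᵥ (λ j → (A *ᵥ v) j + v j)) i  ≡⟨ *ᵥ-congʳ A (Gpoly-*ᵥ-one v) i ⟨
    (A *ᵥ (Gpoly d 1 A *ᵥ v)) i        ∎
    where open ≡-Reasoning
  Gpoly-comm v (suc (suc m)) i = begin
    (Gpoly d (2 ℕ.+ m) A *ᵥ (A *ᵥ v)) i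
      ≡⟨ Gpoly-*ᵥ-step m (A *ᵥ v) i ⟩
    (A *ᵥ (Gpoly d (1 ℕ.+ m) A *ᵥ (A *ᵥ v))) i - c * (Gpoly d m A *ᵥ (A *ᵥ v)) i
      ≡⟨ cong₂ (λ x y → x - c * y) (*ᵥ-congʳ A (Gpoly-comm v (suc m)) i) (Gpoly-comm v m i) ⟩
    (A *ᵥ (A *ᵥ u₁)) i - c * (A *ᵥ u₀) i
      ≡⟨ cong (_-_ ((A *ᵥ (A *ᵥ u₁)) i)) (*ᵥ-scale A c u₀ i) ⟨
    (A *ᵥ (A *ᵥ u₁)) i - (A *ᵥ (λ j → c * u₀ j)) i
      ≡⟨ *ᵥ-minus A (A *ᵥ u₁) (λ j → c * u₀ j) i ⟨
    (A *ᵥ (λ j → (A *ᵥ u₁) j - c * u₀ j)) i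
      ≡⟨ *ᵥ-congʳ A (Gpoly-*ᵥ-step m v) i ⟨
    (A *ᵥ (Gpoly d (2 ℕ.+ m) A *ᵥ v)) i ∎
    where
    open ≡-Reasoning
    u₁ = Gpoly d (1 ℕ.+ m) A *ᵥ v
    u₀ = Gpoly d m A *ᵥ v

b2z-⇔⊎ : ∀ {x y z} → T x ⇔ (T y ⊎ T z) → (T y → T z → ⊥) → b2z x ≡ b2z y + b2z z
b2z-⇔⊎ {true}  {true}  {true}  _  disjoint = ⊥-elim (disjoint _ _)
b2z-⇔⊎ {true}  {true}  {false} _  _ = refl
b2z-⇔⊎ {true}  {false} {true}  _  _ = refl
b2z-⇔⊎ {true}  {false} {false} x⇔ _ with Equivalence.to x⇔ _
... | inj₁ ()
... | inj₂ ()
b2z-⇔⊎ {false} {true}  {_}     x⇔ _ = ⊥-elim (Equivalence.from x⇔ (inj₁ _))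
b2z-⇔⊎ {false} {false} {true}  x⇔ _ = ⊥-elim (Equivalence.from x⇔ (inj₂ _))
b2z-⇔⊎ {false} {false} {false} _  _ = refl

≡ᵇ-⇔ : ∀ {m n} → T (m ≡ᵇ n) ⇔ (m ≡ n)
≡ᵇ-⇔ {m} {n} = mk⇔ (ℕP.≡ᵇ⇒≡ m n) (ℕP.≡⇒≡ᵇ m n)

Consecutive : ℕ → ℕ → ℕ → Set
Consecutive n a b = suc a ≡ b ⊎ suc b ≡ a ⊎ (a ≡ 0 × b ≡ n ℕ.∸ 1) ⊎ (b ≡ 0 × a ≡ n ℕ.∸ 1)

T-cyclicConsec : ∀ n a b → T (cyclicConsec n a b) ⇔ Consecutive n a b
T-cyclicConsec n a b =
  ⇔-trans T-∨ (≡ᵇ-⇔ ⊎-⇔ ⇔-trans T-∨ (≡ᵇ-⇔ ⊎-⇔ ⇔-trans T-∨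
    (⇔-trans T-∧ (≡ᵇ-⇔ ×-⇔ ≡ᵇ-⇔) ⊎-⇔ ⇔-trans T-∧ (≡ᵇ-⇔ ×-⇔ ≡ᵇ-⇔))))

arithmetic-progression : ∀ n (u : ℕ → ℤ) →
                         (∀ a → 2 ℕ.+ a < n → u a + u (2 ℕ.+ a) ≡ + 2 * u (1 ℕ.+ a)) →
                         ∀ a → a < n → u a ≡ u 0 + + a * (u 1 - u 0)
arithmetic-progression n u recurrence zero       _ = sym (ℤP.+-identityʳ (u 0))
arithmetic-progression n u recurrence (suc zero) _ = first-step (u 0) (u 1)
  where
  first-step : ∀ x y → y ≡ x + + 1 * (y - x)
  first-step = solve-∀
arithmetic-progression n u recurrence (suc (suc a)) a+2<n = begin
  u (2 ℕ.+ a)                                      ≡⟨ isolate (u a) (u (1 ℕ.+ a)) (u (2 ℕ.+ a)) (recurrence a a+2<n) ⟩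
  + 2 * u (1 ℕ.+ a) - u a                          ≡⟨ cong₂ (λ x y → + 2 * x - y)
                                                        (arithmetic-progression n u recurrence (suc a) a+1<n)
                                                        (arithmetic-progression n u recurrence a (ℕP.<⇒≤ a+1<n)) ⟩
  + 2 * (u 0 + (+ 1 + + a) * δ) - (u 0 + + a * δ)  ≡⟨ extend (u 0) (+ a) δ ⟩
  u 0 + (+ 1 + (+ 1 + + a)) * δ                    ∎
  where
  open ≡-Reasoning
  δ = u 1 - u 0
  a+1<n = ℕP.<⇒≤ a+2<n
  isolate : ∀ x y z → x + z ≡ + 2 * y → z ≡ + 2 * y - x
  isolate x y z eq = trans (cancel x z) (cong (_- x) eq)
    where
    cancel : ∀ x z → z ≡ x + z - x
    cancel = solve-∀
  extend : ∀ u₀ a δ → + 2 * (u₀ + (+ 1 + a) * δ) - (u₀ + a * δ) ≡ u₀ + (+ 1 + (+ 1 + a)) * δ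
  extend = solve-∀

unit-involution : ∀ s x → s * s ≡ + 1 → s * (s * x) ≡ x
unit-involution s x s²≡1 = trans (sym (ℤP.*-assoc s s x)) (trans (cong (_* x) s²≡1) (ℤP.*-identityˡ x))

alt : ℕ → ℤ
alt zero    = + 1
alt (suc a) = - alt a

alt-±1 : ∀ a → alt a ≡ + 1 ⊎ alt a ≡ - + 1
alt-±1 zero    = inj₁ refl
alt-±1 (suc a) with alt-±1 a
... | inj₁ eq = inj₂ (cong -_ eq)
... | inj₂ eq = inj₁ (cong -_ eq)

alt²≡1 : ∀ a → alt a * alt a ≡ + 1
alt²≡1 a with alt-±1 a
... | inj₁ eq rewrite eq = refl
... | inj₂ eq rewrite eq = refl

alt-suc-suc : ∀ a → alt (suc (suc a)) ≡ alt a
alt-suc-suc a = ℤP.neg-involutive (alt a)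

alt-even : ∀ q → alt (q ℕ.* 2) ≡ + 1
alt-even zero    = refl
alt-even (suc q) = trans (alt-suc-suc (q ℕ.* 2)) (alt-even q)

sum-alt-even : ∀ q → sum (λ (p : Fin (q ℕ.* 2)) → alt (toℕ p)) ≡ + 0
sum-alt-even zero    = refl
sum-alt-even (suc q) = begin
  + 1 + (- + 1 + sum (λ (p : Fin (q ℕ.* 2)) → alt (2 ℕ.+ toℕ p)))
    ≡⟨ cong (λ s → + 1 + (- + 1 + s)) (sum-cong-≗ {q ℕ.* 2} (λ p → alt-suc-suc (toℕ p))) ⟩
  + 1 + (- + 1 + sum (λ (p : Fin (q ℕ.* 2)) → alt (toℕ p)))
    ≡⟨ cong (λ s → + 1 + (- + 1 + s)) (sum-alt-even q) ⟩
  + 0 ∎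
  where open ≡-Reasoning

module CycleOfLength (k : ℕ) where

  N : ℕ
  N = 3 ℕ.+ k

  L : ℕ
  L = 2 ℕ.+ k

  prev : ℕ → ℕ
  prev zero    = L
  prev (suc a) = a

  next : ℕ → ℕ
  next a = suc a % N

  prev< : ∀ {a} → a < N → prev a < N
  prev< {zero}  _   = ℕP.n<1+n L
  prev< {suc a} a<N = ℕP.<⇒≤ a<N

  next< : ∀ a → next a < N
  next< a = m%n<n (suc a) N

  next-suc : ∀ {a} → suc a < N → next a ≡ suc a
  next-suc = m<n⇒m%n≡m

  next-last : next L ≡ 0
  next-last = n%n≡0 N

  suc<-or-last : ∀ {a} → a < N → suc a < N ⊎ a ≡ L
  suc<-or-last a<N = Sum.map₁ s≤s (ℕP.m<1+n⇒m<n∨m≡n a<N)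

  consecutive⇒prev-or-next : ∀ {a b} → b < N → Consecutive N a b → b ≡ prev a ⊎ b ≡ next a
  consecutive⇒prev-or-next b<N (inj₁ refl)                        = inj₂ (sym (next-suc b<N))
  consecutive⇒prev-or-next _   (inj₂ (inj₁ refl))                 = inj₁ refl
  consecutive⇒prev-or-next _   (inj₂ (inj₂ (inj₁ (refl , refl)))) = inj₁ refl
  consecutive⇒prev-or-next _   (inj₂ (inj₂ (inj₂ (refl , refl)))) = inj₂ (sym next-last)

  prev-or-next⇒consecutive : ∀ {a b} → a < N → b ≡ prev a ⊎ b ≡ next a → Consecutive N a b
  prev-or-next⇒consecutive {zero}  _ (inj₁ refl) = inj₂ (inj₂ (inj₁ (refl , refl)))
  prev-or-next⇒consecutive {suc a} _ (inj₁ refl) = inj₂ (inj₁ refl)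
  prev-or-next⇒consecutive a<N (inj₂ refl) with suc<-or-last a<N
  ... | inj₁ a+1<N = inj₁ (sym (next-suc a+1<N))
  ... | inj₂ refl  = inj₂ (inj₂ (inj₂ (next-last , refl)))

  prev≢next : ∀ {a} → a < N → prev a ≢ next a
  prev≢next {zero}  _   L≡next0 = ℕP.1+n≢0 (ℕP.suc-injective (trans L≡next0 (next-suc (s≤s (s≤s z≤n)))))
  prev≢next {suc a} a<N a≡next with suc<-or-last a<N
  ... | inj₁ a+2<N = ℕP.<-irrefl (trans a≡next (next-suc a+2<N)) (s≤s (ℕP.n≤1+n a))
  ... | inj₂ refl  = ℕP.1+n≢0 (trans a≡next next-last)

  cyclicConsec-split : ∀ {a b} → a < N → b < N →
                       b2z (cyclicConsec N a b) ≡ b2z (b ≡ᵇ prev a) + b2z (b ≡ᵇ next a)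
  cyclicConsec-split {a} {b} a<N b<N = b2z-⇔⊎
    (⇔-trans (T-cyclicConsec N a b)
      (⇔-trans (mk⇔ (consecutive⇒prev-or-next b<N) (prev-or-next⇒consecutive a<N))
               (⇔-sym ≡ᵇ-⇔ ⊎-⇔ ⇔-sym ≡ᵇ-⇔)))
    (λ b≡prev b≡next → prev≢next a<N (trans (sym (ℕP.≡ᵇ⇒≡ b _ b≡prev)) (ℕP.≡ᵇ⇒≡ b _ b≡next)))

  sum-cyclicConsec : ∀ {a} → a < N → (f : ℕ → ℤ) →
                     sum (λ (p : Fin N) → b2z (cyclicConsec N a (toℕ p)) * f (toℕ p)) ≡ f (prev a) + f (next a)
  sum-cyclicConsec {a} a<N f = begin
    sum (λ (p : Fin N) → b2z (cyclicConsec N a (toℕ p)) * f (toℕ p))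
      ≡⟨ sum-cong-≗ {N} (λ p → trans (cong (_* f (toℕ p)) (cyclicConsec-split a<N (toℕ<n p)))
                                     (ℤP.*-distribʳ-+ (f (toℕ p)) (δ (prev a) p) (δ (next a) p))) ⟩
    sum (λ (p : Fin N) → δ (prev a) p * f (toℕ p) + δ (next a) p * f (toℕ p))
      ≡⟨ ∑-distrib-+ (λ p → δ (prev a) p * f (toℕ p)) (λ p → δ (next a) p * f (toℕ p)) ⟩
    sum (λ (p : Fin N) → δ (prev a) p * f (toℕ p)) + sum (λ (p : Fin N) → δ (next a) p * f (toℕ p))
      ≡⟨ cong₂ _+_ (sum-δ (prev a) (prev< a<N) f) (sum-δ (next a) (next< a) f) ⟩
    f (prev a) + f (next a) ∎
    where
    open ≡-Reasoning
    δ : ℕ → Fin N → ℤ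
    δ c p = b2z (toℕ p ≡ᵇ c)

  -- u is an arithmetic progression along the path 0, 1, …, N − 1, and closing the cycle at 0 forces
  -- N times its difference to vanish.
  harmonic-constant : ∀ (u : ℕ → ℤ) → (∀ a → a < N → u (prev a) + u (next a) ≡ + 2 * u a) →
                      ∀ a → a < N → u a ≡ u 0
  harmonic-constant u harmonic a a<N = begin
    u a              ≡⟨ progression a a<N ⟩
    u 0 + + a * δ    ≡⟨ cong (λ x → u 0 + + a * x) δ≡0 ⟩
    u 0 + + a * + 0  ≡⟨ cong (_+_ (u 0)) (ℤP.*-zeroʳ (+ a)) ⟩
    u 0 + + 0        ≡⟨ ℤP.+-identityʳ (u 0) ⟩
    u 0              ∎
    where
    open ≡-Reasoning
    δ = u 1 - u 0
    progression = arithmetic-progression N u λ b b+2<N →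
      subst (λ x → u b + u x ≡ + 2 * u (suc b)) (next-suc b+2<N) (harmonic (suc b) (ℕP.<⇒≤ b+2<N))
    closing : ∀ u₀ u₁ l → (+ 1 + l) * (u₁ - u₀) ≡ (u₀ + l * (u₁ - u₀)) + u₁ - + 2 * u₀
    closing = solve-∀
    Nδ≡0 : + N * δ ≡ + 0
    Nδ≡0 = begin
      + N * δ                              ≡⟨ closing (u 0) (u 1) (+ L) ⟩
      (u 0 + + L * δ) + u 1 - + 2 * u 0    ≡⟨ cong (λ x → x + u 1 - + 2 * u 0) (progression L (ℕP.n<1+n L)) ⟨
      u L + u 1 - + 2 * u 0                ≡⟨ cong (λ x → u L + u x - + 2 * u 0) (next-suc (s≤s (s≤s z≤n))) ⟨
      u (prev 0) + u (next 0) - + 2 * u 0  ≡⟨ cong (_- + 2 * u 0) (harmonic 0 (s≤s z≤n)) ⟩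
      + 2 * u 0 - + 2 * u 0                ≡⟨ ℤP.+-inverseʳ (+ 2 * u 0) ⟩
      + 0                                  ∎
    δ≡0 : δ ≡ + 0
    δ≡0 = ℤP.*-cancelˡ-≡ (+ N) δ (+ 0) (trans Nδ≡0 (sym (ℤP.*-zeroʳ (+ N))))

  module _ (N-even : 2 ∣ N) where
    open _∣_ N-even using (quotient; equality)

    alt-N : alt N ≡ + 1
    alt-N = trans (cong alt equality) (alt-even quotient)

    alt-prev : ∀ {a} → a < N → alt (prev a) ≡ - alt a
    alt-prev {zero}  _ = trans (sym (ℤP.neg-involutive (alt L))) (cong -_ alt-N)
    alt-prev {suc a} _ = sym (ℤP.neg-involutive (alt a))

    alt-next : ∀ {a} → a < N → alt (next a) ≡ - alt a
    alt-next a<N with suc<-or-last a<N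
    ... | inj₁ a+1<N = cong alt (next-suc a+1<N)
    ... | inj₂ refl  = trans (cong alt next-last) (sym alt-N)

    sum-alt : sum (λ (p : Fin N) → alt (toℕ p)) ≡ + 0
    sum-alt = subst (λ n → sum (λ (p : Fin n) → alt (toℕ p)) ≡ + 0) (sym equality) (sum-alt-even quotient)

    alternating-kernel : ∀ (f : ℕ → ℤ) → (∀ a → a < N → f (prev a) + f (next a) ≡ - + 2 * f a) →
                         ∀ a → a < N → f a ≡ alt a * f 0
    alternating-kernel f eigen a a<N = begin
      f a                  ≡⟨ unit-involution (alt a) (f a) (alt²≡1 a) ⟨
      alt a * u a          ≡⟨ cong (alt a *_) (harmonic-constant u harmonic a a<N) ⟩
      alt a * (+ 1 * f 0)  ≡⟨ cong (alt a *_) (ℤP.*-identityˡ (f 0)) ⟩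
      alt a * f 0          ∎
      where
      open ≡-Reasoning
      u : ℕ → ℤ
      u b = alt b * f b
      harmonic : ∀ b → b < N → u (prev b) + u (next b) ≡ + 2 * u b
      harmonic b b<N = begin
        alt (prev b) * f (prev b) + alt (next b) * f (next b)
          ≡⟨ cong₂ (λ s t → s * f (prev b) + t * f (next b)) (alt-prev b<N) (alt-next b<N) ⟩
        - alt b * f (prev b) + - alt b * f (next b)
          ≡⟨ ℤP.*-distribˡ-+ (- alt b) (f (prev b)) (f (next b)) ⟨
        - alt b * (f (prev b) + f (next b))
          ≡⟨ cong (- alt b *_) (eigen b b<N) ⟩
        - alt b * (- + 2 * f b)
          ≡⟨ rearrange (alt b) (f b) ⟩
        + 2 * (alt b * f b) ∎
        where
        rearrange : ∀ s x → - s * (- + 2 * x) ≡ + 2 * (s * x)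
        rearrange = solve-∀

module CycleOrder {k : ℕ} (π : Permutation′ (3 ℕ.+ k)) where
  open CycleOfLength k

  pos : Fin N → ℕ
  pos i = toℕ (π ⟨$⟩ʳ i)

  pos<N : ∀ i → pos i < N
  pos<N i = toℕ<n (π ⟨$⟩ʳ i)

  vertexAt : ℕ → Fin N
  vertexAt a = π ⟨$⟩ˡ (a mod N)

  pos-vertexAt : ∀ {a} → a < N → pos (vertexAt a) ≡ a
  pos-vertexAt a<N = trans (cong toℕ (inverseʳ π)) (trans (toℕ-fromℕ< _) (m<n⇒m%n≡m a<N))

  vertexAt-pos : ∀ i → vertexAt (pos i) ≡ i
  vertexAt-pos i =
    trans (cong (π ⟨$⟩ˡ_) (toℕ-injective (trans (toℕ-fromℕ< _) (m<n⇒m%n≡m (pos<N i))))) (inverseˡ π)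

  sum-pos : ∀ (h : ℕ → ℤ) → sum (λ i → h (pos i)) ≡ sum (λ (p : Fin N) → h (toℕ p))
  sum-pos h = sym (sum-permute (λ p → h (toℕ p)) π)

  cycleMat-*ᵥ : ∀ {B} → B ≋ cycleMat π → ∀ f →
                B *ᵥ (λ j → f (pos j)) ≗ λ i → f (prev (pos i)) + f (next (pos i))
  cycleMat-*ᵥ {B} B≋ f i = begin
    (B *ᵥ (λ j → f (pos j))) i
      ≡⟨ *ᵥ-congˡ B≋ (λ j → f (pos j)) i ⟩
    sum (λ j → b2z (cyclicConsec N (pos i) (pos j)) * f (pos j))
      ≡⟨ sum-pos (λ b → b2z (cyclicConsec N (pos i) b) * f b) ⟩
    sum (λ (p : Fin N) → b2z (cyclicConsec N (pos i) (toℕ p)) * f (toℕ p))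
      ≡⟨ sum-cyclicConsec (pos<N i) f ⟩
    f (prev (pos i)) + f (next (pos i)) ∎
    where open ≡-Reasoning

module CyclicIdentity {k d m : ℕ} (Γ : Graph (3 ℕ.+ k)) (regular : Regular d Γ)
                      (π : Permutation′ (3 ℕ.+ k)) {B : Mat (3 ℕ.+ k)} (B≋ : B ≋ cycleMat π)
                      {ε : ℤ} (ε²≡1 : ε * ε ≡ + 1) (identity : Gpoly d m (adjMat Γ) ≋ (Jm ⊕ (ε · B))) where
  open CycleOfLength k
  open CycleOrder π

  A : Mat N
  A = adjMat Γ

  G-*ᵥ : ∀ v → Gpoly d m A *ᵥ v ≗ λ i → sum v + ε * (B *ᵥ v) i
  G-*ᵥ v i = trans (*ᵥ-congˡ identity v i)
    (trans (⊕-*ᵥ Jm (ε · B) v i) (cong₂ _+_ (Jm-*ᵥ v i) (·-*ᵥ ε B v i)))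

  row-sum : ∀ i → sum (A i) ≡ + d
  row-sum i = trans (sym (sumFin≡sum (A i))) (regular i)

  column-sum : ∀ j → sum (λ i → A i j) ≡ + d
  column-sum j = trans (sum-cong-≗ (λ i → cong b2z (symm Γ i j))) (row-sum j)

  sum-A*ᵥ : ∀ v → sum (A *ᵥ v) ≡ + d * sum v
  sum-A*ᵥ v = begin
    sum (λ i → sum (λ j → A i j * v j))  ≡⟨ ∑-comm (λ i j → A i j * v j) ⟩
    sum (λ j → sum (λ i → A i j * v j))  ≡⟨ sum-cong-≗ (λ j → *-distribʳ-sum (v j) (λ i → A i j)) ⟨
    sum (λ j → sum (λ i → A i j) * v j)  ≡⟨ sum-cong-≗ (λ j → cong (_* v j) (column-sum j)) ⟩
    sum (λ j → + d * v j)                ≡⟨ *-distribˡ-sum (+ d) v ⟨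
    + d * sum v                          ∎
    where open ≡-Reasoning

  Gscalar-degree : Gscalar d m (+ d) ≡ + N + ε * + 2
  Gscalar-degree = begin
    Gscalar d m (+ d)                ≡⟨ ℤP.*-identityʳ (Gscalar d m (+ d)) ⟨
    Gscalar d m (+ d) * + 1          ≡⟨ Gpoly-eigen d A (+ d) ones A-ones m zero ⟨
    (Gpoly d m A *ᵥ ones) zero       ≡⟨ G-*ᵥ ones zero ⟩
    sum ones + ε * (B *ᵥ ones) zero  ≡⟨ cong₂ (λ x y → x + ε * y) (sum-ones N)
                                                  (cycleMat-*ᵥ B≋ (λ _ → + 1) zero) ⟩
    + N + ε * + 2                    ∎
    where
    open ≡-Reasoning
    ones : Vector ℤ N
    ones _ = + 1
    A-ones : A *ᵥ ones ≗ λ i → + d * ones i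
    A-ones i = trans (sum-cong-≗ (λ j → ℤP.*-identityʳ (A i j))) (trans (row-sum i) (sym (ℤP.*-identityʳ (+ d))))

  cycle-length-even : 1 ≤ m → + 2 ℤ∣.∣ + (d ℕ.∸ 1) → + 2 ℤ∣.∣ + d + + 1 → 2 ∣ N
  cycle-length-even 1≤m 2∣d-1 2∣d+1 = ℤ∣.∣⇒∣ᵤ (subst (+ 2 ℤ∣.∣_) (cancel (+ N) ε)
    (ℤ∣.∣m∣n⇒∣m-n (subst (+ 2 ℤ∣.∣_) Gscalar-degree (Gscalar-even d (+ d) 2∣d+1 2∣d-1 1≤m))
                  (ℤ∣.∣n⇒∣m*n ε ℤ∣.∣-refl)))
    where
    cancel : ∀ n e → n + e * + 2 - e * + 2 ≡ n
    cancel = solve-∀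

  module _ (N-even : 2 ∣ N) where

    z : Vector ℤ N
    z i = alt (pos i)

    sum-z : sum z ≡ + 0
    sum-z = trans (sum-pos alt) (sum-alt N-even)

    B-z : B *ᵥ z ≗ λ i → - + 2 * z i
    B-z i = begin
      (B *ᵥ z) i                               ≡⟨ cycleMat-*ᵥ B≋ alt i ⟩
      alt (prev (pos i)) + alt (next (pos i))  ≡⟨ cong₂ _+_ (alt-prev N-even (pos<N i)) (alt-next N-even (pos<N i)) ⟩
      - z i + - z i                            ≡⟨ double (z i) ⟩
      - + 2 * z i                              ∎
      where
      open ≡-Reasoning
      double : ∀ x → - x + - x ≡ - + 2 * x
      double = solve-∀

    G-z : Gpoly d m A *ᵥ z ≗ λ i → - (+ 2 * ε) * z i
    G-z i = trans (G-*ᵥ z i) (trans (cong₂ (λ s y → s + ε * y) sum-z (B-z i)) (regroup ε (z i)))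
      where
      regroup : ∀ e x → + 0 + e * (- + 2 * x) ≡ - (+ 2 * e) * x
      regroup = solve-∀

    w : Vector ℤ N
    w = A *ᵥ z

    B-w : B *ᵥ w ≗ λ i → - + 2 * w i
    B-w i = begin
      (B *ᵥ w) i               ≡⟨ unit-involution ε _ ε²≡1 ⟨
      ε * (ε * (B *ᵥ w) i)     ≡⟨ cong (ε *_) ε-B-w ⟩
      ε * (ε * (- + 2 * w i))  ≡⟨ unit-involution ε _ ε²≡1 ⟩
      - + 2 * w i              ∎
      where
      open ≡-Reasoning
      sum-w : sum w ≡ + 0
      sum-w = trans (sum-A*ᵥ z) (trans (cong (+ d *_) sum-z) (ℤP.*-zeroʳ (+ d)))
      regroup : ∀ e x → - (+ 2 * e) * x ≡ e * (- + 2 * x)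
      regroup = solve-∀
      ε-B-w : ε * (B *ᵥ w) i ≡ ε * (- + 2 * w i)
      ε-B-w = begin
        ε * (B *ᵥ w) i                      ≡⟨ ℤP.+-identityˡ _ ⟨
        + 0 + ε * (B *ᵥ w) i                ≡⟨ cong (λ s → s + ε * (B *ᵥ w) i) sum-w ⟨
        sum w + ε * (B *ᵥ w) i              ≡⟨ G-*ᵥ w i ⟨
        (Gpoly d m A *ᵥ (A *ᵥ z)) i         ≡⟨ Gpoly-comm d A z m i ⟩
        (A *ᵥ (Gpoly d m A *ᵥ z)) i         ≡⟨ *ᵥ-congʳ A G-z i ⟩
        (A *ᵥ (λ j → - (+ 2 * ε) * z j)) i  ≡⟨ *ᵥ-scale A (- (+ 2 * ε)) z i ⟩
        - (+ 2 * ε) * w i                   ≡⟨ regroup ε (w i) ⟩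
        ε * (- + 2 * w i)                   ∎

    θ : ℤ
    θ = w (vertexAt 0)

    A-z : A *ᵥ z ≗ λ i → θ * z i
    A-z i = begin
      w i              ≡⟨ cong w (vertexAt-pos i) ⟨
      f (pos i)        ≡⟨ alternating-kernel N-even f f-eigen (pos i) (pos<N i) ⟩
      alt (pos i) * θ  ≡⟨ ℤP.*-comm (alt (pos i)) θ ⟩
      θ * z i          ∎
      where
      open ≡-Reasoning
      f : ℕ → ℤ
      f a = w (vertexAt a)
      f-eigen : ∀ a → a < N → f (prev a) + f (next a) ≡ - + 2 * f a
      f-eigen a a<N = begin
        f (prev a) + f (next a)
          ≡⟨ cong (λ b → f (prev b) + f (next b)) (pos-vertexAt a<N) ⟨
        f (prev (pos (vertexAt a))) + f (next (pos (vertexAt a)))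
          ≡⟨ cycleMat-*ᵥ B≋ f (vertexAt a) ⟨
        (B *ᵥ (λ j → f (pos j))) (vertexAt a)
          ≡⟨ *ᵥ-congʳ B (λ j → cong w (vertexAt-pos j)) (vertexAt a) ⟩
        (B *ᵥ w) (vertexAt a)
          ≡⟨ B-w (vertexAt a) ⟩
        - + 2 * f a ∎

    Gscalar-θ : Gscalar d m θ ≡ - (+ 2 * ε)
    Gscalar-θ = begin
      Gscalar d m θ           ≡⟨ ℤP.*-identityʳ _ ⟨
      Gscalar d m θ * + 1     ≡⟨ cong (Gscalar d m θ *_) z-v₀ ⟨
      Gscalar d m θ * z v₀    ≡⟨ Gpoly-eigen d A θ z A-z m v₀ ⟨
      (Gpoly d m A *ᵥ z) v₀   ≡⟨ G-z v₀ ⟩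
      - (+ 2 * ε) * z v₀      ≡⟨ cong (- (+ 2 * ε) *_) z-v₀ ⟩
      - (+ 2 * ε) * + 1       ≡⟨ ℤP.*-identityʳ _ ⟩
      - (+ 2 * ε)             ∎
      where
      open ≡-Reasoning
      v₀ = vertexAt 0
      z-v₀ : z v₀ ≡ + 1
      z-v₀ = cong alt (pos-vertexAt (s≤s z≤n))

    θ≡d-2t : ∃ λ t → t ≤ d × θ ≡ + d - + 2 * + t
    θ≡d-2t with signed-count (adj Γ (vertexAt 0)) z (λ j → alt-±1 (pos j))
    ... | c , t , count , t≤c , total with ℤP.+-injective (trans (sym count) (row-sum (vertexAt 0)))
    ...   | refl = t , t≤c , total

  alternating-eigenvalue : 1 ≤ m → + 2 ℤ∣.∣ + (d ℕ.∸ 1) → + 2 ℤ∣.∣ + d + + 1 →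
                           ∃ λ t → t ≤ d × Gscalar d m (+ d - + 2 * + t) ≡ - (+ 2 * ε)
  alternating-eigenvalue 1≤m 2∣d-1 2∣d+1 =
    let N-even         = cycle-length-even 1≤m 2∣d-1 2∣d+1
        t , t≤d , θ≡ = θ≡d-2t N-even
    in t , t≤d , subst (λ x → Gscalar d m x ≡ - (+ 2 * ε)) θ≡ (Gscalar-θ N-even)

module _ {A : Set} (f : A → A) (x : A) (P : ℕ) (period : fold x f P ≡ x) where

  fold-multiple : ∀ q → fold x f (q ℕ.* P) ≡ x
  fold-multiple zero    = refl
  fold-multiple (suc q) = trans (fold-+ x f P) (trans (cong (λ y → fold y f P) (fold-multiple q)) period)

  fold-periodic : ∀ j .{{_ : NonZero P}} → fold x f j ≡ fold x f (j % P)
  fold-periodic j = begin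
    fold x f j                                   ≡⟨ cong (fold x f) (m≡m%n+[m/n]*n j P) ⟩
    fold x f (j % P ℕ.+ (j ℕ./ P) ℕ.* P)         ≡⟨ fold-+ x f (j % P) ⟩
    fold (fold x f ((j ℕ./ P) ℕ.* P)) f (j % P)  ≡⟨ cong (λ y → fold y f (j % P)) (fold-multiple (j ℕ./ P)) ⟩
    fold x f (j % P)                             ∎
    where open ≡-Reasoning

-- recur acts on pairs of consecutive residues modulo M, so its orbit from start m₀ follows
-- G_{d,m}(θ) modulo M from m = m₀ on; a period P and a check of the first P residues then
-- exclude the value c for all m ≥ m₀.
module ResidueOrbit (d : ℕ) (θ : ℤ) (M : ℕ) .{{_ : NonZero M}} where

  reduce : ℤ → ℤ
  reduce x = + (x %ℕ M)

  ∣-reduce : ∀ x → + M ℤ∣.∣ x - reduce x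
  ∣-reduce x = divides (x /ℕ M)
    (trans (cong (_- reduce x) (a≡a%ℕn+[a/ℕn]*n x M)) (cancel (reduce x) (x /ℕ M * + M)))
    where
    cancel : ∀ r y → r + y - r ≡ y
    cancel = solve-∀

  recur : ℤ × ℤ → ℤ × ℤ
  recur (r , s) = s , reduce (θ * s - + (d ℕ.∸ 1) * r)

  Tracks : ℕ → ℤ × ℤ → Set
  Tracks m (r , s) = + M ℤ∣.∣ Gscalar d m θ - r × + M ℤ∣.∣ Gscalar d (suc m) θ - s

  tracks-recur : ∀ {m} p → Tracks m p → Tracks (suc m) (recur p)
  tracks-recur {m} (r , s) (M∣r , M∣s) = M∣s , subst (+ M ℤ∣.∣_)
    (split θ c (Gscalar d (suc m) θ) (Gscalar d m θ) r s (reduce X))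
    (ℤ∣.∣m∣n⇒∣m+n (ℤ∣.∣m∣n⇒∣m-n (ℤ∣.∣n⇒∣m*n θ M∣s) (ℤ∣.∣n⇒∣m*n c M∣r))
                  (∣-reduce X))
    where
    c = + (d ℕ.∸ 1)
    X = θ * s - c * r
    split : ∀ t c g₁ g₀ r s R → t * (g₁ - s) - c * (g₀ - r) + (t * s - c * r - R) ≡ t * g₁ - c * g₀ - R
    split = solve-∀

  start : ℕ → ℤ × ℤ
  start m = reduce (Gscalar d m θ) , reduce (Gscalar d (suc m) θ)

  tracks-orbit : ∀ m₀ j → Tracks (j ℕ.+ m₀) (fold (start m₀) recur j)
  tracks-orbit m₀ zero    = ∣-reduce (Gscalar d m₀ θ) , ∣-reduce (Gscalar d (suc m₀) θ)
  tracks-orbit m₀ (suc j) = tracks-recur {j ℕ.+ m₀} _ (tracks-orbit m₀ j)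

  Avoids : ℕ → ℕ → ℤ → Set
  Avoids m₀ P c = ∀ (i : Fin P) → ¬ (+ M ℤ∣.∣ c - proj₁ (fold (start m₀) recur (toℕ i)))

  avoids? : ∀ m₀ P c → Dec (Avoids m₀ P c)
  avoids? m₀ P c = all? λ i → ¬? (+ M ∣? c - proj₁ (fold (start m₀) recur (toℕ i)))

  never-hits : ∀ m₀ P c .{{_ : NonZero P}} → fold (start m₀) recur P ≡ start m₀ → True (avoids? m₀ P c) →
               ∀ m → m₀ ≤ m → Gscalar d m θ ≢ c
  never-hits m₀ P c period avoids m m₀≤m hit = toWitness avoids (j mod P)
    (subst₂ (λ g r → + M ℤ∣.∣ g - proj₁ r)
      (trans (cong (λ n → Gscalar d n θ) (ℕP.m∸n+n≡m m₀≤m)) hit)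
      (trans (fold-periodic recur (start m₀) P period j)
             (cong (fold (start m₀) recur) (sym (toℕ-fromℕ< (m%n<n j P)))))
      (proj₁ (tracks-orbit m₀ j)))
    where
    j = m ℕ.∸ m₀

-- The arguments of never-hits are: degree, θ = 7 − 2t, modulus M, first index, period P, excluded value.
no-defect-value : ∀ t → t ≤ 7 → ∀ m → 3 ≤ m → Gscalar 7 m (+ 7 - + 2 * + t) ≢ - + 2
no-defect-value 0 _ = ResidueOrbit.never-hits 7 (+ 7)   3 3 1 (- + 2) refl _
no-defect-value 1 _ = ResidueOrbit.never-hits 7 (+ 5)   3 3 1 (- + 2) refl _
no-defect-value 2 _ = ResidueOrbit.never-hits 7 (+ 3)   3 3 1 (- + 2) refl _
no-defect-value 3 _ = ResidueOrbit.never-hits 7 (+ 1)   3 3 1 (- + 2) refl _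
no-defect-value 4 _ = ResidueOrbit.never-hits 7 (- + 1) 3 3 1 (- + 2) refl _
no-defect-value 5 _ = ResidueOrbit.never-hits 7 (- + 3) 3 3 1 (- + 2) refl _
no-defect-value 6 _ = ResidueOrbit.never-hits 7 (- + 5) 3 3 1 (- + 2) refl _
no-defect-value 7 _ = ResidueOrbit.never-hits 7 (- + 7) 3 3 1 (- + 2) refl _
no-defect-value (suc (suc (suc (suc (suc (suc (suc (suc _))))))))
                (s≤s (s≤s (s≤s (s≤s (s≤s (s≤s (s≤s ())))))))

no-excess-value : ∀ t → t ≤ 7 → ∀ m → 3 ≤ m → Gscalar 7 m (+ 7 - + 2 * + t) ≢ + 2
no-excess-value 0 _ = ResidueOrbit.never-hits 7 (+ 7)   7 3 1 (+ 2) refl _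
no-excess-value 1 _ = ResidueOrbit.never-hits 7 (+ 5)   3 3 1 (+ 2) refl _
no-excess-value 2 _ = ResidueOrbit.never-hits 7 (+ 3)   3 3 1 (+ 2) refl _
no-excess-value 3 _ = ResidueOrbit.never-hits 7 (+ 1)   4 3 1 (+ 2) refl _
no-excess-value 4 _ = ResidueOrbit.never-hits 7 (- + 1) 3 3 1 (+ 2) refl _
no-excess-value 5 _ = ResidueOrbit.never-hits 7 (- + 3) 3 3 1 (+ 2) refl _
no-excess-value 6 _ = ResidueOrbit.never-hits 7 (- + 5) 5 3 4 (+ 2) refl _
no-excess-value 7 _ = ResidueOrbit.never-hits 7 (- + 7) 3 3 1 (+ 2) refl _
no-excess-value (suc (suc (suc (suc (suc (suc (suc (suc _))))))))
                (s≤s (s≤s (s≤s (s≤s (s≤s (s≤s (s≤s ())))))))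

theorem7 : ((D : ℕ) → 3 ≤ D → (n : ℕ) → (Γ : Graph n) → ¬ CyclicDefect Γ 7 D)
         × ((g : ℕ) → 7 ≤ g → g % 2 ≡ 1 → (n : ℕ) → (Γ : Graph n) → ¬ CyclicExcess Γ 7 g)
theorem7 = no-defect , no-excess
  where
  2∣6 : + 2 ℤ∣.∣ + 6
  2∣6 = divides (+ 3) refl

  2∣8 : + 2 ℤ∣.∣ + 8
  2∣8 = divides (+ 4) refl

  no-defect : (D : ℕ) → 3 ≤ D → (n : ℕ) → (Γ : Graph n) → ¬ CyclicDefect Γ 7 D
  no-defect D 3≤D _ Γ (_ , regular , _ , _ , B , (s≤s (s≤s (s≤s z≤n)) , π , B≋) , identity) =
    let t , t≤7 , value = CyclicIdentity.alternating-eigenvalue {m = D} Γ regular π B≋ {ε = + 1} refl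
                            (λ i j → trans (identity i j) (cong (_+_ (+ 1)) (sym (ℤP.*-identityˡ (B i j)))))
                            (ℕP.≤-trans (s≤s z≤n) 3≤D) 2∣6 2∣8
    in no-defect-value t t≤7 D 3≤D value

  no-excess : (g : ℕ) → 7 ≤ g → g % 2 ≡ 1 → (n : ℕ) → (Γ : Graph n) → ¬ CyclicExcess Γ 7 g
  no-excess g 7≤g _ _ Γ (_ , regular , _ , _ , _ , B , (s≤s (s≤s (s≤s z≤n)) , π , B≋) , identity) =
    let 3≤m             = /-monoˡ-≤ 2 7≤g
        t , t≤7 , value = CyclicIdentity.alternating-eigenvalue {m = g ℕ./ 2} Γ regular π B≋ {ε = - + 1} refl
                            (λ i j → trans (identity i j) (cong (_+_ (+ 1)) (sym (ℤP.-1*i≡-i (B i j)))))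
                            (ℕP.≤-trans (s≤s z≤n) 3≤m) 2∣6 2∣8
    in no-excess-value t t≤7 (g ℕ./ 2) 3≤m value
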